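{- If a finite simple graph $\Gamma$ is hypersolvable, then so is every induced subgraph of $\Gamma$.
   Context: Let $\Gamma$ have edge set $E$. For $S\subseteq T\subseteq E$, the containment $S\subseteq T$ is solvable if: (a) there is no $3$-cycle in $\Gamma$ with two edges in $S$ and one edge in $T\setminus S$; and (b) either $T\setminus S=\{e\}$ for an edge $e$ neither of whose endpoints is met by $S$, or there exist distinct vertices $v_1,\dots,v_k,v$ met by $T$, with $v_1,\dots,v_k$ met by $S$, such that $S$ contains a clique on $\{v_1,\dots,v_k\}$ and $T\setminus S=\{vv_s\in E: s=1,\dots,k\}$. A hypersolvable composition series for $\Gamma$ is a chain $S_1\subseteq\dots\subseteq S_k=E$ with $|S_1|=1$ and each $S_i\subseteq S_{i+1}$ solvable. $\Gamma$ is hypersolvable if it admits a hypersolvable composition series. -}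

module Defs where

open import Data.Nat using (ℕ)
open import Data.Fin using (Fin)
open import Data.Bool using (Bool; true; false)
open import Data.Product using (Σ; ∃; ∃-syntax; _×_; _,_)
open import Data.Sum using (_⊎_)
open import Relation.Binary.PropositionalEquality using (_≡_; _≢_)
open import Relation.Nullary using (¬_)
open import Function.Bundles using (_⇔_)
open import Function.Definitions using (Injective)

record Graph : Set where
  field
    n      : ℕ
    adj    : Fin n → Fin n → Bool
    sym    : ∀ i j → adj i j ≡ adj j i
    irrefl : ∀ i → adj i i ≡ false

open Graph public

-- A set of (unordered) pairs of vertices, encoded as a Boolean matrix;
-- {x,y} ∈ S  iff  S x y ≡ true.
EdgeSet : ℕ → Set
EdgeSet n = Fin n → Fin n → Bool

_∋ₑ_,_ : ∀ {n} → EdgeSet n → Fin n → Fin n → Set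
S ∋ₑ x , y = S x y ≡ true

IsEdgeSubset : (Γ : Graph) → EdgeSet (n Γ) → Set
IsEdgeSubset Γ S =
  (∀ x y → S x y ≡ S y x) × (∀ x y → S ∋ₑ x , y → adj Γ ∋ₑ x , y)

_⊆ₑ_ : ∀ {n} → EdgeSet n → EdgeSet n → Set
S ⊆ₑ T = ∀ x y → S ∋ₑ x , y → T ∋ₑ x , y

_≐ₑ_ : ∀ {n} → EdgeSet n → EdgeSet n → Set
S ≐ₑ T = ∀ x y → S x y ≡ T x y

MetBy : ∀ {n} → Fin n → EdgeSet n → Set
MetBy x S = ∃[ y ] (S ∋ₑ x , y)

SamePair : ∀ {n} → Fin n → Fin n → Fin n → Fin n → Set
SamePair x y u w = (x ≡ u × y ≡ w) ⊎ (x ≡ w × y ≡ u)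

InDiff : ∀ {n} → EdgeSet n → EdgeSet n → Fin n → Fin n → Set
InDiff S T x y = T ∋ₑ x , y × ¬ (S ∋ₑ x , y)

IsSingleton : (Γ : Graph) → EdgeSet (n Γ) → Set
IsSingleton Γ S =
  ∃[ u ] ∃[ w ] (adj Γ ∋ₑ u , w ×
    (∀ x y → (S ∋ₑ x , y) ⇔ SamePair x y u w))

NoBadTriangle : (Γ : Graph) → EdgeSet (n Γ) → EdgeSet (n Γ) → Set
NoBadTriangle Γ S T =
  ¬ (∃[ x ] ∃[ y ] ∃[ z ]
      (adj Γ ∋ₑ x , y × adj Γ ∋ₑ y , z × adj Γ ∋ₑ x , z ×
       S ∋ₑ x , y × S ∋ₑ y , z × InDiff S T x z))

SingleNewEdge : (Γ : Graph) → EdgeSet (n Γ) → EdgeSet (n Γ) → Set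
SingleNewEdge Γ S T =
  ∃[ u ] ∃[ w ] (adj Γ ∋ₑ u , w ×
    (∀ x y → InDiff S T x y ⇔ SamePair x y u w) ×
    ¬ MetBy u S × ¬ MetBy w S)

ConeOverClique : (Γ : Graph) → EdgeSet (n Γ) → EdgeSet (n Γ) → Set
ConeOverClique Γ S T =
  ∃[ k ] Σ (Fin k → Fin (n Γ)) λ vs → ∃[ v ]
    ( Injective _≡_ _≡_ vs
    × (∀ s → vs s ≢ v)
    × MetBy v T
    × (∀ s → MetBy (vs s) T)
    × (∀ s → MetBy (vs s) S)
    × (∀ s t → s ≢ t → S ∋ₑ vs s , vs t)
    × (∀ x y → InDiff S T x y ⇔
         (∃[ s ] (SamePair x y v (vs s) × adj Γ ∋ₑ v , vs s))))

Solvable : (Γ : Graph) → EdgeSet (n Γ) → EdgeSet (n Γ) → Set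
Solvable Γ S T =
  NoBadTriangle Γ S T × (SingleNewEdge Γ S T ⊎ ConeOverClique Γ S T)

data ChainToE (Γ : Graph) : EdgeSet (n Γ) → Set where
  done : ∀ {S} → S ≐ₑ adj Γ → ChainToE Γ S
  step : ∀ {S} (T : EdgeSet (n Γ)) → IsEdgeSubset Γ T → S ⊆ₑ T →
         Solvable Γ S T → ChainToE Γ T → ChainToE Γ S

Hypersolvable : Graph → Set
Hypersolvable Γ =
  ∃[ S₁ ] (IsEdgeSubset Γ S₁ × IsSingleton Γ S₁ × ChainToE Γ S₁)

induced : (Γ : Graph) (m : ℕ) (f : Fin m → Fin (n Γ)) → Graph
induced Γ m f = record
  { n      = m
  ; adj    = λ i j → adj Γ (f i) (f j)
  ; sym    = λ i j → sym Γ (f i) (f j)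
  ; irrefl = λ i → irrefl Γ (f i)
  }

HasEdge : Graph → Set
HasEdge Γ = ∃[ x ] ∃[ y ] (adj Γ ∋ₑ x , y)

-- Idea.  Restrict every edge set S of a hypersolvable composition series of
-- Γ to the induced subgraph Γ' (keep the pairs of vertices of Γ').  Two
-- consecutive restrictions are either equal, and then the step is simply
-- dropped, or the restricted containment is again solvable: condition (a)
-- restricts verbatim, a single new edge survives only with both endpoints,
-- and a cone over a clique survives as a cone over the surviving base
-- vertices -- or, if only one base vertex survives, as a single new edge.
--
-- A series is recast as a chain of solvable steps starting at
-- the empty edge set (the first step of such a chain always adds exactly one
-- edge).
module Submission where

open import Defs hiding (sym)
open import Data.Nat using (ℕ)
open import Data.Fin using (Fin; zero; suc)
open import Data.Fin.Properties using (any?; _≟_)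
open import Data.Bool using (true; false)
import Data.Bool.Properties as Bool
open import Data.Product using (∃-syntax; _×_; _,_; proj₁; proj₂)
open import Data.Sum using (_⊎_; inj₁; inj₂)
open import Data.Empty using (⊥-elim)
open import Data.List using (List; _∷_; filter; allFin; lookup; length)
import Data.List.Relation.Unary.All as All
open import Data.List.Relation.Unary.Any using (index)
open import Data.List.Relation.Unary.Any.Properties using (lookup-index)
open import Data.List.Relation.Unary.AllPairs using (_∷_)
open import Data.List.Relation.Unary.Unique.Propositional using (Unique)
import Data.List.Relation.Unary.Unique.Propositional.Properties as Unique
open import Data.List.Membership.Propositional.Properties
  using (∈-filter⁺; ∈-filter⁻; ∈-lookup; ∈-allFin)
open import Relation.Binary.PropositionalEquality
open import Relation.Nullary using (Dec; yes; no; ¬_)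
open import Relation.Nullary.Decidable using (_×-dec_; ¬?)
open import Relation.Unary using (Decidable)
open import Function.Bundles using (_⇔_; mk⇔; Equivalence)
open import Function.Definitions using (Injective)

open Equivalence using (to; from)

-- Enumerating decidable subsets of Fin m

lookup-injective : ∀ {A : Set} (xs : List A) → Unique xs →
  ∀ {i j} → lookup xs i ≡ lookup xs j → i ≡ j
lookup-injective (x ∷ xs) (x∉xs ∷ u) {zero}  {zero}  e = refl
lookup-injective (x ∷ xs) (x∉xs ∷ u) {zero}  {suc j} e = ⊥-elim (All.lookup x∉xs (∈-lookup j) e)
lookup-injective (x ∷ xs) (x∉xs ∷ u) {suc i} {zero}  e = ⊥-elim (All.lookup x∉xs (∈-lookup i) (sym e))
lookup-injective (x ∷ xs) (x∉xs ∷ u) {suc i} {suc j} e = cong suc (lookup-injective xs u e)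

-- An injective listing elem : Fin size → Fin m of exactly the elements
-- satisfying P; the base of a cone has to be presented in this form.
record Enumeration {m : ℕ} (P : Fin m → Set) : Set where
  field
    size      : ℕ
    elem      : Fin size → Fin m
    injective : Injective _≡_ _≡_ elem
    sound     : ∀ s → P (elem s)
    complete  : ∀ b → P b → ∃[ s ] (elem s ≡ b)

enumerate : ∀ {m} {P : Fin m → Set} → Decidable P → Enumeration P
enumerate {m} P? = record
  { size      = length L
  ; elem      = lookup L
  ; injective = lookup-injective L (Unique.filter⁺ P? (Unique.allFin⁺ m))
  ; sound     = λ s → proj₂ (∈-filter⁻ P? {xs = allFin m} (∈-lookup s))
  ; complete  = λ b Pb → let b∈L = ∈-filter⁺ P? (∈-allFin b) Pb
                         in index b∈L , sym (lookup-index b∈L)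
  }
  where
    L : List (Fin m)
    L = filter P? (allFin m)

-- Edge sets

true≢false : true ≢ false
true≢false ()

module _ {k : ℕ} where

  ∅ₑ : EdgeSet k
  ∅ₑ _ _ = false

  ≐⇒⊆ : {S R : EdgeSet k} → S ≐ₑ R → S ⊆ₑ R
  ≐⇒⊆ S≐R x y p = trans (sym (S≐R x y)) p

  ≐-sym : {S R : EdgeSet k} → S ≐ₑ R → R ≐ₑ S
  ≐-sym S≐R x y = sym (S≐R x y)

  metBy-⊆ : {S R : EdgeSet k} → S ⊆ₑ R → ∀ {x} → MetBy x S → MetBy x R
  metBy-⊆ S⊆R (y , p) = y , S⊆R _ y p

  inDiff-≐ : {S R T : EdgeSet k} → S ≐ₑ R → ∀ {x y} → InDiff S T x y → InDiff R T x y
  inDiff-≐ S≐R (t , s∉S) = t , λ s∈R → s∉S (≐⇒⊆ (≐-sym S≐R) _ _ s∈R)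

  diff-≐ : {S R T : EdgeSet k} {Q : Fin k → Fin k → Set} → S ≐ₑ R →
    (∀ x y → InDiff S T x y ⇔ Q x y) → ∀ x y → InDiff R T x y ⇔ Q x y
  diff-≐ {T = T} S≐R new x y =
    mk⇔ (λ d → to (new x y) (inDiff-≐ {T = T} (≐-sym S≐R) d))
        (λ q → inDiff-≐ {T = T} S≐R (from (new x y) q))

  no-diff⇒≐ : {S T : EdgeSet k} → S ⊆ₑ T → (∀ x y → ¬ InDiff S T x y) → S ≐ₑ T
  no-diff⇒≐ {S} {T} S⊆T nothing-new x y with S x y in s | T x y in t
  ... | true  | true  = refl
  ... | false | false = refl
  ... | true  | false = ⊥-elim (true≢false (trans (sym (S⊆T x y s)) t))
  ... | false | true  = ⊥-elim (nothing-new x y (t , λ p → true≢false (trans (sym p) s)))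

  metBy? : ∀ x (S : EdgeSet k) → Dec (MetBy x S)
  metBy? x S = any? (λ y → S x y Bool.≟ true)

  inDiff? : ∀ (S T : EdgeSet k) x y → Dec (InDiff S T x y)
  inDiff? S T x y = (T x y Bool.≟ true) ×-dec ¬? (S x y Bool.≟ true)

  samePair-swap : ∀ {x y u w : Fin k} → SamePair x y u w → SamePair x y w u
  samePair-swap (inj₁ eqs) = inj₂ eqs
  samePair-swap (inj₂ eqs) = inj₁ eqs

samePair-map : ∀ {k l} (g : Fin k → Fin l) {x y u w} →
  SamePair x y u w → SamePair (g x) (g y) (g u) (g w)
samePair-map g (inj₁ (p , q)) = inj₁ (cong g p , cong g q)
samePair-map g (inj₂ (p , q)) = inj₂ (cong g p , cong g q)

adj-sym : (G : Graph) → ∀ {x y} → adj G ∋ₑ x , y → adj G ∋ₑ y , x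
adj-sym G {x} {y} p = trans (Graph.sym G y x) p

adj-irrefl : (G : Graph) → ∀ {x y} → adj G ∋ₑ x , y → x ≢ y
adj-irrefl G {x} p refl = true≢false (trans (sym p) (irrefl G x))

-- Chains of solvable steps

-- Solvability of S ⊆ T, and hence a chain starting at S, depends on S only
-- up to ≐ₑ; this lets a step with equal restrictions be dropped.
solvable-≐ : (G : Graph) {S R T : EdgeSet (n G)} → S ≐ₑ R → Solvable G S T → Solvable G R T
solvable-≐ G {S} {R} {T} S≐R (no-bad , alternative) = no-bad′ , alternative′ alternative
  where
    R⊆S : R ⊆ₑ S
    R⊆S = ≐⇒⊆ (≐-sym S≐R)
    no-bad′ : NoBadTriangle G R T
    no-bad′ (x , y , z , xy , yz , xz , xy∈R , yz∈R , xz-new) =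
      no-bad (x , y , z , xy , yz , xz , R⊆S x y xy∈R , R⊆S y z yz∈R ,
              inDiff-≐ {T = T} (≐-sym S≐R) xz-new)
    alternative′ : SingleNewEdge G S T ⊎ ConeOverClique G S T →
                   SingleNewEdge G R T ⊎ ConeOverClique G R T
    alternative′ (inj₁ (u , w , uw , new , u-free , w-free)) =
      inj₁ (u , w , uw , diff-≐ S≐R new ,
            (λ u-met → u-free (metBy-⊆ R⊆S u-met)) , (λ w-met → w-free (metBy-⊆ R⊆S w-met)))
    alternative′ (inj₂ (k , vs , v , vs-inj , vs≢v , v-met , vs-metT , vs-metS , clique , new)) =
      inj₂ (k , vs , v , vs-inj , vs≢v , v-met , vs-metT ,
            (λ s → metBy-⊆ (≐⇒⊆ S≐R) (vs-metS s)) ,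
            (λ s t s≢t → ≐⇒⊆ S≐R _ _ (clique s t s≢t)) , diff-≐ S≐R new)

chain-≐ : ∀ {G S R} → S ≐ₑ R → ChainToE G S → ChainToE G R
chain-≐ S≐R (done S≐E) = done (λ x y → trans (sym (S≐R x y)) (S≐E x y))
chain-≐ {G} S≐R (step T T⊆E S⊆T solvable chain) =
  step T T⊆E (λ x y p → S⊆T x y (≐⇒⊆ (≐-sym S≐R) x y p)) (solvable-≐ G S≐R solvable) chain

-- Adding a single edge to ∅ is solvable ...
singleton-solvable : (G : Graph) {T : EdgeSet (n G)} → IsSingleton G T → Solvable G ∅ₑ T
singleton-solvable G (u , w , uw , T≡uw) =
  (λ { (_ , _ , _ , _ , _ , _ , () , _) }) ,
  inj₁ (u , w , uw ,
        (λ x y → mk⇔ (λ d → to (T≡uw x y) (proj₁ d)) (λ sp → from (T≡uw x y) sp , λ ())) ,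
        (λ { (_ , ()) }) , (λ { (_ , ()) }))

-- ... and it is the only solvable step out of ∅: a cone would need a base
-- vertex met by ∅.
solvable-from-∅ : (G : Graph) {T : EdgeSet (n G)} → Solvable G ∅ₑ T → IsSingleton G T
solvable-from-∅ G (_ , inj₁ (u , w , uw , new , _)) =
  u , w , uw , λ x y → mk⇔ (λ p → to (new x y) (p , λ ())) (λ sp → proj₁ (from (new x y) sp))
solvable-from-∅ G (_ , inj₂ (_ , _ , v , _ , _ , (y , vy∈T) , _ , vs-met , _ , new))
  with vs-met (proj₁ (to (new v y) (vy∈T , λ ())))
... | _ , ()

hypersolvable⇒chain-from-∅ : (G : Graph) → Hypersolvable G → ChainToE G ∅ₑ
hypersolvable⇒chain-from-∅ G (S₁ , S₁⊆E , singleton , chain) =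
  step S₁ S₁⊆E (λ _ _ ()) (singleton-solvable G singleton) chain

chain-from-∅⇒hypersolvable : (G : Graph) → HasEdge G → ChainToE G ∅ₑ → Hypersolvable G
chain-from-∅⇒hypersolvable G (x , y , xy) (done ∅≐E) =
  ⊥-elim (true≢false (sym (trans (∅≐E x y) xy)))
chain-from-∅⇒hypersolvable G _ (step T T⊆E _ solvable chain) =
  T , T⊆E , solvable-from-∅ G solvable , chain

-- The two shapes of condition (b)

cone-over-decidable-clique : (G : Graph) {S T : EdgeSet (n G)}
  (v : Fin (n G)) (C : Fin (n G) → Set) → Decidable C → S ⊆ₑ T → MetBy v T →
  (∀ b → C b → b ≢ v) → (∀ b → C b → MetBy b S) →
  (∀ b c → C b → C c → b ≢ c → S ∋ₑ b , c) →
  (∀ x y → InDiff S T x y ⇔ (∃[ b ] (C b × SamePair x y v b × adj G ∋ₑ v , b))) →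
  ConeOverClique G S T
cone-over-decidable-clique G {S} {T} v C C? S⊆T v-met C≢v C-met clique new =
  size , elem , v , injective , (λ s → C≢v (elem s) (sound s)) , v-met ,
  (λ s → metBy-⊆ S⊆T (C-met (elem s) (sound s))) ,
  (λ s → C-met (elem s) (sound s)) ,
  (λ s t s≢t → clique (elem s) (elem t) (sound s) (sound t) (λ e → s≢t (injective e))) ,
  (λ x y → mk⇔ (listed x y) (λ (s , sp , vb) → from (new x y) (elem s , sound s , sp , vb)))
  where
    open Enumeration (enumerate C?)
    listed : ∀ x y → InDiff S T x y →
             ∃[ s ] (SamePair x y v (elem s) × adj G ∋ₑ v , elem s)
    listed x y d with to (new x y) d
    ... | b , Cb , rest with complete b Cb
    ... | s , refl = s , rest

-- A step adding exactly one edge uw whose endpoint w is met by S is a cone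
-- over the one-vertex clique {w} with apex u.
cone-over-edge : (G : Graph) {S T : EdgeSet (n G)} {u w : Fin (n G)} →
  S ⊆ₑ T → adj G ∋ₑ u , w → (∀ x y → InDiff S T x y ⇔ SamePair x y u w) →
  MetBy w S → ConeOverClique G S T
cone-over-edge G {u = u} {w} S⊆T uw new w-met =
  cone-over-decidable-clique G u (_≡ w) (_≟ w) S⊆T
    (w , proj₁ (from (new u w) (inj₁ (refl , refl))))
    (λ { _ refl w≡u → adj-irrefl G uw (sym w≡u) }) (λ { _ refl → w-met })
    (λ { _ _ refl refl w≢w → ⊥-elim (w≢w refl) })
    (λ x y → mk⇔ (λ d → w , refl , to (new x y) d , uw)
                 (λ { (_ , refl , sp , _) → from (new x y) sp }))

-- A step adding exactly one edge uw always satisfies (b): as a single new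
-- edge if neither endpoint is met by S, otherwise as a cone over a met
-- endpoint.
new-edge-alternative : (G : Graph) {S T : EdgeSet (n G)} {u w : Fin (n G)} →
  S ⊆ₑ T → adj G ∋ₑ u , w → (∀ x y → InDiff S T x y ⇔ SamePair x y u w) →
  SingleNewEdge G S T ⊎ ConeOverClique G S T
new-edge-alternative G {S} {T} {u} {w} S⊆T uw new with metBy? u S | metBy? w S
... | _         | yes w-met = inj₂ (cone-over-edge G S⊆T uw new w-met)
... | yes u-met | no _      = inj₂ (cone-over-edge G S⊆T (adj-sym G uw) new-wu u-met)
  where
    new-wu : ∀ x y → InDiff S T x y ⇔ SamePair x y w u
    new-wu x y = mk⇔ (λ d → samePair-swap (to (new x y) d))
                     (λ sp → from (new x y) (samePair-swap sp))
... | no u-free | no w-free = inj₁ (u , w , uw , new , u-free , w-free)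

-- Restriction to an induced subgraph

module Restriction (Γ : Graph) (m : ℕ) (f : Fin m → Fin (n Γ))
                   (f-injective : Injective _≡_ _≡_ f) where

  Γ′ : Graph
  Γ′ = induced Γ m f

  res : EdgeSet (n Γ) → EdgeSet m
  res S x y = S (f x) (f y)

  res-⊆ : ∀ {S T} → S ⊆ₑ T → res S ⊆ₑ res T
  res-⊆ S⊆T x y = S⊆T (f x) (f y)

  res-edgeSubset : ∀ {S} → IsEdgeSubset Γ S → IsEdgeSubset Γ′ (res S)
  res-edgeSubset (S-sym , S⊆E) = (λ x y → S-sym (f x) (f y)) , (λ x y → S⊆E (f x) (f y))

  res-noBadTriangle : ∀ {S T} → NoBadTriangle Γ S T → NoBadTriangle Γ′ (res S) (res T)
  res-noBadTriangle no-bad (x , y , z , rest) = no-bad (f x , f y , f z , rest)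

  samePair-reflect : ∀ {x y u w} → SamePair (f x) (f y) (f u) (f w) → SamePair x y u w
  samePair-reflect (inj₁ (p , q)) = inj₁ (f-injective p , f-injective q)
  samePair-reflect (inj₂ (p , q)) = inj₂ (f-injective p , f-injective q)

  endpoints-in-image : ∀ {x y u w} → SamePair (f x) (f y) u w →
                       (∃[ a ] (f a ≡ u)) × (∃[ b ] (f b ≡ w))
  endpoints-in-image {x} {y} (inj₁ (p , q)) = (x , p) , (y , q)
  endpoints-in-image {x} {y} (inj₂ (p , q)) = (y , q) , (x , p)

  res-single-edge : ∀ {S T u w} → S ⊆ₑ T → adj Γ ∋ₑ u , w →
    (∀ x y → InDiff S T x y ⇔ SamePair x y u w) →
    ∀ {x y} → InDiff (res S) (res T) x y →
    SingleNewEdge Γ′ (res S) (res T) ⊎ ConeOverClique Γ′ (res S) (res T)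
  res-single-edge S⊆T uw new d with endpoints-in-image (to (new _ _) d)
  ... | (a , refl) , (b , refl) =
    new-edge-alternative Γ′ (res-⊆ S⊆T) uw λ x y →
      mk⇔ (λ d → samePair-reflect (to (new (f x) (f y)) d))
          (λ sp → from (new (f x) (f y)) (samePair-map f sp))

  module ConeRestriction {S T : EdgeSet (n Γ)} {k : ℕ} (vs : Fin k → Fin (n Γ))
    (a : Fin m) (vs≢apex : ∀ s → vs s ≢ f a) (clique : ∀ s t → s ≢ t → S ∋ₑ vs s , vs t)
    (new : ∀ x y → InDiff S T x y ⇔ (∃[ s ] (SamePair x y (f a) (vs s) × adj Γ ∋ₑ f a , vs s)))
    where

    Base : Fin m → Set
    Base b = ∃[ s ] (f b ≡ vs s)

    base? : Decidable Base
    base? b = any? (λ s → f b ≟ vs s)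

    base≢apex : ∀ b → Base b → b ≢ a
    base≢apex b (s , fb≡vs) b≡a = vs≢apex s (trans (sym fb≡vs) (cong f b≡a))

    base-clique : ∀ b c → Base b → Base c → b ≢ c → res S ∋ₑ b , c
    base-clique b c (s , fb≡) (t , fc≡) b≢c =
      subst₂ (λ p q → S p q ≡ true) (sym fb≡) (sym fc≡)
        (clique s t (λ s≡t → b≢c (f-injective (trans fb≡ (trans (cong vs s≡t) (sym fc≡))))))

    res-new : ∀ x y → InDiff (res S) (res T) x y ⇔
              (∃[ b ] (Base b × SamePair x y a b × adj Γ′ ∋ₑ a , b))
    res-new x y = mk⇔ forth back
      where
        forth : InDiff (res S) (res T) x y → ∃[ b ] (Base b × SamePair x y a b × adj Γ′ ∋ₑ a , b)
        forth d with to (new (f x) (f y)) d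
        ... | s , sp , a-vs with proj₂ (endpoints-in-image sp)
        ... | b , fb≡ =
          b , (s , fb≡) ,
          samePair-reflect (subst (SamePair (f x) (f y) (f a)) (sym fb≡) sp) ,
          subst (λ z → adj Γ (f a) z ≡ true) (sym fb≡) a-vs
        back : ∃[ b ] (Base b × SamePair x y a b × adj Γ′ ∋ₑ a , b) → InDiff (res S) (res T) x y
        back (b , (s , fb≡) , sp , ab) =
          from (new (f x) (f y))
            (s , subst (SamePair (f x) (f y) (f a)) fb≡ (samePair-map f sp) ,
                 subst (λ z → adj Γ (f a) z ≡ true) fb≡ ab)

    -- With two surviving base vertices every base vertex is met by the
    -- restricted clique, giving a cone; with one, just one edge is new.
    res-cone : S ⊆ₑ T → ∀ {x y} → InDiff (res S) (res T) x y →
               SingleNewEdge Γ′ (res S) (res T) ⊎ ConeOverClique Γ′ (res S) (res T)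
    res-cone S⊆T d with to (res-new _ _) d
    ... | b₀ , base-b₀ , _ , ab₀ with any? (λ b → ¬? (b ≟ b₀) ×-dec base? b)
    ... | yes (b₁ , b₁≢b₀ , base-b₁) =
      inj₂ (cone-over-decidable-clique Γ′ a Base base? (res-⊆ S⊆T)
              (b₀ , proj₁ (from (res-new a b₀) (b₀ , base-b₀ , inj₁ (refl , refl) , ab₀)))
              base≢apex base-met base-clique res-new)
      where
        base-met : ∀ b → Base b → MetBy b (res S)
        base-met b base-b with b ≟ b₀
        ... | yes refl = b₁ , base-clique b b₁ base-b base-b₁ (λ b≡b₁ → b₁≢b₀ (sym b≡b₁))
        ... | no b≢b₀  = b₀ , base-clique b b₀ base-b base-b₀ b≢b₀
    ... | no no-other = new-edge-alternative Γ′ (res-⊆ S⊆T) ab₀ only-ab₀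
      where
        unique : ∀ b → Base b → b ≡ b₀
        unique b base-b with b ≟ b₀
        ... | yes b≡b₀ = b≡b₀
        ... | no b≢b₀  = ⊥-elim (no-other (b , b≢b₀ , base-b))
        only-ab₀ : ∀ x y → InDiff (res S) (res T) x y ⇔ SamePair x y a b₀
        only-ab₀ x y =
          mk⇔ (λ d → let (b , base-b , sp , _) = to (res-new x y) d
                     in subst (SamePair x y a) (unique b base-b) sp)
              (λ sp → from (res-new x y) (b₀ , base-b₀ , sp , ab₀))

  res-solvable : ∀ {S T} → S ⊆ₑ T → Solvable Γ S T →
    ∀ {x y} → InDiff (res S) (res T) x y → Solvable Γ′ (res S) (res T)
  res-solvable S⊆T (no-bad , inj₁ (u , w , uw , new , _)) d =
    res-noBadTriangle no-bad , res-single-edge S⊆T uw new d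
  res-solvable S⊆T (no-bad , inj₂ (k , vs , v , _ , vs≢v , _ , _ , _ , clique , new)) d
    with to (new _ _) d
  ... | s , sp , _ with proj₁ (endpoints-in-image sp)
  ... | a , refl =
    res-noBadTriangle no-bad , ConeRestriction.res-cone vs a vs≢v clique new S⊆T d

  res-step : ∀ {S T} → S ⊆ₑ T → Solvable Γ S T →
             (res S ≐ₑ res T) ⊎ Solvable Γ′ (res S) (res T)
  res-step {S} {T} S⊆T solvable
    with any? (λ x → any? (λ y → inDiff? (res S) (res T) x y))
  ... | yes (x , y , d) = inj₂ (res-solvable S⊆T solvable d)
  ... | no nothing-new  =
    inj₁ (no-diff⇒≐ (res-⊆ S⊆T) (λ x y d → nothing-new (x , y , d)))

  res-chain : ∀ {S} → ChainToE Γ S → ChainToE Γ′ (res S)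
  res-chain (done S≐E) = done (λ x y → S≐E (f x) (f y))
  res-chain (step T T⊆E S⊆T solvable chain) with res-step S⊆T solvable
  ... | inj₁ resS≐resT = chain-≐ (≐-sym resS≐resT) (res-chain chain)
  ... | inj₂ solvable′ = step (res T) (res-edgeSubset T⊆E) (res-⊆ S⊆T) solvable′ (res-chain chain)

proposition4p11 : (Γ : Graph) → Hypersolvable Γ →
    (m : ℕ) (f : Fin m → Fin (n Γ)) → Injective _≡_ _≡_ f →
    HasEdge (induced Γ m f) → Hypersolvable (induced Γ m f)
proposition4p11 Γ hypersolvable m f f-injective has-edge =
  chain-from-∅⇒hypersolvable Γ′ has-edge (res-chain (hypersolvable⇒chain-from-∅ Γ hypersolvable))
  where open Restriction Γ m f f-injective
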